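{- For every positive integer $n$, the set $\mathcal{P}^i_{\rm ncn}(n)$ of indecomposable partitions of $[n]$ that are both noncrossing and nonnesting and the set $\mathcal{P}_{\rm tn}(n)$ of totally nested partitions of $[n]$ have the same cardinality.
   Context: A partition of $[n]=\{1,\dots,n\}$ has arc diagram with an arc $(i,j)$, $i<j$, whenever $i,j$ are consecutive elements of the same block. Arcs $(i_1,j_1),(i_2,j_2)$ cross if $i_1<i_2<j_1<j_2$ and nest if $i_1<i_2<j_2<j_1$; noncrossing/nonnesting means no such pair. A partition of $[n]$ is indecomposable if no subset of its blocks is a partition of $[k]$ for some $k<n$. A block $B=\{i_1<\dots<i_r\}$ is nested by a block $B'=\{j_1<\dots<j_s\}$ if there is an index $\ell$ with $j_\ell<i_1<\dots<i_r<j_{\ell+1}$. A partition $\pi$ of $[n]$ is totally nested if its blocks can be listed as $B_1,\dots,B_k$ so that either $k=1$ or for every $1<i\le k$ the block $B_i$ is nested by $B_{i-1}$. -}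

module Defs where

open import Data.Nat using (ℕ; zero; suc; _≤_; _<_)
open import Data.Fin using (Fin; toℕ)
open import Data.Vec using (Vec; lookup)
open import Data.List using (List)
open import Data.List.Membership.Propositional using (_∈_)
open import Data.List.Relation.Unary.Unique.Propositional using (Unique)
open import Data.List.Relation.Unary.Linked using (Linked)
open import Data.Product using (Σ; ∃; ∃-syntax; _×_; proj₁)
open import Function.Bundles using (_⇔_)
open import Relation.Nullary using (¬_)
open import Relation.Binary.Bundles using (Setoid)
open import Relation.Binary.PropositionalEquality using (_≡_; _≢_)
import Relation.Binary.PropositionalEquality as P
import Relation.Binary.Construct.On as On

-- Set partitions of [n] are encoded canonically by restricted growth
-- functions a : Vec ℕ n (positions 0..n-1 stand for 1..n; i and j are
-- in the same block iff a[i] = a[j]; blocks are labelled 0,1,2,... in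
-- order of their minima).

_⟨<⟩_ : ∀ {n} → Fin n → Fin n → Set
i ⟨<⟩ j = toℕ i < toℕ j

-- restricted growth condition: a nonzero label v first appears only
-- after label v-1 has appeared (equivalently a₁ = 0 and
-- a_i ≤ 1 + max_{j<i} a_j).
IsRGF : ∀ {n} → Vec ℕ n → Set
IsRGF {n} a = ∀ (i : Fin n) → lookup a i ≢ 0 →
  ∃[ j ] (j ⟨<⟩ i × suc (lookup a j) ≡ lookup a i)

Arc : ∀ {n} → Vec ℕ n → Fin n → Fin n → Set
Arc {n} a i j = i ⟨<⟩ j × lookup a i ≡ lookup a j ×
  (∀ (k : Fin n) → i ⟨<⟩ k → k ⟨<⟩ j → lookup a k ≢ lookup a i)

Noncrossing : ∀ {n} → Vec ℕ n → Set
Noncrossing {n} a = ∀ (i₁ j₁ i₂ j₂ : Fin n) → Arc a i₁ j₁ → Arc a i₂ j₂ →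
  ¬ (i₁ ⟨<⟩ i₂ × i₂ ⟨<⟩ j₁ × j₁ ⟨<⟩ j₂)

Nonnesting : ∀ {n} → Vec ℕ n → Set
Nonnesting {n} a = ∀ (i₁ j₁ i₂ j₂ : Fin n) → Arc a i₁ j₁ → Arc a i₂ j₂ →
  ¬ (i₁ ⟨<⟩ i₂ × i₂ ⟨<⟩ j₂ × j₂ ⟨<⟩ j₁)

BlocksPartition : ∀ {n} → Vec ℕ n → List ℕ → ℕ → Set
BlocksPartition {n} a S k = ∀ (i : Fin n) → (toℕ i < k) ⇔ (lookup a i ∈ S)

Indecomposable : ∀ {n} → Vec ℕ n → Set
Indecomposable {n} a = ∀ (k : ℕ) → 1 ≤ k → k < n →
  ¬ (Σ (List ℕ) λ S → BlocksPartition a S k)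

NestedBy : ∀ {n} → Vec ℕ n → ℕ → ℕ → Set
NestedBy {n} a b b' = ∃[ j ] ∃[ j' ] (lookup a j ≡ b' × Arc a j j' ×
  (∀ (i : Fin n) → lookup a i ≡ b → j ⟨<⟩ i × i ⟨<⟩ j'))

ListsBlocks : ∀ {n} → Vec ℕ n → List ℕ → Set
ListsBlocks a L = Unique L × (∀ v → (v ∈ L) ⇔ (∃[ i ] lookup a i ≡ v))

TotallyNested : ∀ {n} → Vec ℕ n → Set
TotallyNested a = Σ (List ℕ) λ L → ListsBlocks a L ×
  Linked (λ b' b → NestedBy a b b') L

PartSetoid : (n : ℕ) → (Vec ℕ n → Set) → Setoid _ _
PartSetoid n Q = On.setoid {B = Σ (Vec ℕ n) λ a → IsRGF a × Q a}
  (P.setoid (Vec ℕ n)) proj₁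

Pincn : ℕ → Setoid _ _
Pincn n = PartSetoid n λ a → Indecomposable a × Noncrossing a × Nonnesting a

Ptn : ℕ → Setoid _ _
Ptn n = PartSetoid n TotallyNested

-- Both sets are in bijection with the subsets of the n − 2 inner positions.
--
-- In an indecomposable noncrossing nonnesting partition every gap is spanned by an arc, and two
-- arcs spanning the same gap lie in one block, as they would otherwise cross or nest.  Hence all
-- arcs lie in the block of 1, which therefore contains n, and all other blocks are singletons (a
-- `Comb`); such a partition is determined by its set of inner singletons.
--
-- Writing a totally nested partition as the word of its nesting depths gives a `Mountain`: a word
-- from 0 to 0 with steps in {−1, 0, 1} that never ascends after a descent, since the positions
-- above depth t form the gap between two consecutive elements of depth t.  A mountain is
-- determined by the set of positions where it changes: its height at p is min(C, T − C), where C
-- counts the changes up to p and T, which is even, counts all of them.  Conversely every set of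
-- inner positions is the change set of such a word, the last step restoring the parity of T.

module Submission where

open import Data.Bool using (Bool; true; false; _∧_; if_then_else_)
open import Data.Empty using (⊥; ⊥-elim)
open import Data.Fin using (Fin; toℕ; fromℕ<; fromℕ)
open import Data.Fin.Properties using (toℕ<n; toℕ-fromℕ<; toℕ-fromℕ; toℕ-injective)
open import Data.List as List using (List; []; _∷_; length; map; upTo)
open import Data.List.Membership.Propositional using (_∈_)
open import Data.List.Membership.Propositional.Properties
  using (∈-lookup; ∈-map⁺; ∈-map⁻; ∈-upTo⁺; ∈-upTo⁻)
open import Data.List.Relation.Unary.All as All using ()
open import Data.List.Relation.Unary.AllPairs using (_∷_)
open import Data.List.Relation.Unary.Any as Any using ()
open import Data.List.Relation.Unary.Any.Properties using (lookup-index)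
open import Data.List.Relation.Unary.Linked using (Linked; [-]; _∷_)
import Data.List.Relation.Unary.Linked.Properties as Linked
open import Data.List.Relation.Unary.Unique.Propositional using (Unique)
open import Data.List.Relation.Unary.Unique.Propositional.Properties using (upTo⁺)
open import Data.Nat using (ℕ; zero; suc; pred; _+_; _∸_; _⊓_; _≤_; _<_; _≟_; _≤?_; _<?_; z≤n; s≤s; ⌈_/2⌉)
open import Data.Nat.Induction using (<-wellFounded)
open import Data.Nat.Properties
open import Algebra.Properties.CommutativeSemigroup +-commutativeSemigroup
  using (x∙yz≈y∙xz; xy∙z≈y∙xz)
open import Data.Product using (∃; ∃-syntax; _×_; _,_; proj₁; proj₂)
open import Data.Sum using (_⊎_; inj₁; inj₂)
open import Data.Vec using (Vec; []; _∷_; lookup)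
open import Function.Bundles using (Bijection; _⇔_; mk⇔; Equivalence)
open import Function.Construct.Composition using (bijection)
open import Induction.WellFounded using (Acc; acc)
open import Level using (0ℓ)
open import Relation.Binary.Bundles using (Setoid)
open import Relation.Binary.Definitions using (tri<; tri≈; tri>)
open import Relation.Binary.PropositionalEquality
open import Relation.Nullary using (¬_; Dec; yes; no)
open import Relation.Nullary.Decidable using (isYes; isNo; _×-dec_; decidable-stable)
open import Relation.Unary using (Pred; Decidable)

open import Defs

open ≤-Reasoning

at : ∀ {n} → Vec ℕ n → ℕ → ℕ
at []       p       = 0
at (x ∷ xs) zero    = x
at (x ∷ xs) (suc p) = at xs p

lookup≡at : ∀ {n} (a : Vec ℕ n) i → lookup a i ≡ at a (toℕ i)
lookup≡at (x ∷ a) Fin.zero    = refl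
lookup≡at (x ∷ a) (Fin.suc i) = lookup≡at a i

lookup-fromℕ< : ∀ {n} (a : Vec ℕ n) {p} (p<n : p < n) → lookup a (fromℕ< p<n) ≡ at a p
lookup-fromℕ< a p<n = trans (lookup≡at a (fromℕ< p<n)) (cong (at a) (toℕ-fromℕ< p<n))

vec : (n : ℕ) → (ℕ → ℕ) → Vec ℕ n
vec zero    f = []
vec (suc n) f = f 0 ∷ vec n (λ p → f (suc p))

at-vec : ∀ n f {p} → p < n → at (vec n f) p ≡ f p
at-vec (suc n) f {zero}  _         = refl
at-vec (suc n) f {suc p} (s≤s p<n) = at-vec n (λ q → f (suc q)) p<n

lookup-vec : ∀ n f (i : Fin n) → lookup (vec n f) i ≡ f (toℕ i)
lookup-vec n f i = trans (lookup≡at (vec n f) i) (at-vec n f (toℕ<n i))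

at-injective : ∀ {n} {a b : Vec ℕ n} → (∀ {p} → p < n → at a p ≡ at b p) → a ≡ b
at-injective {a = []}    {[]}    _  = refl
at-injective {a = x ∷ a} {y ∷ b} eq =
  cong₂ _∷_ (eq (s≤s z≤n)) (at-injective λ p<n → eq (s≤s p<n))

least : ∀ {P : Pred ℕ 0ℓ} → Decidable P → ∀ {m} → P m →
        ∃[ q ] (q ≤ m × P q × (∀ {r} → r < q → ¬ P r))
least {P} P? = go (<-wellFounded _)
  where
  go : ∀ {m} → Acc _<_ m → P m → ∃[ q ] (q ≤ m × P q × (∀ {r} → r < q → ¬ P r))
  go {m} (acc rs) Pm with anyUpTo? P? m
  ... | no none = m , ≤-refl , Pm , λ r<m Pr → none (_ , r<m , Pr)
  ... | yes (q , q<m , Pq) with go (rs q<m) Pq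
  ...   | r , r≤q , Pr , min = r , ≤-trans r≤q (<⇒≤ q<m) , Pr , min

greatest : ∀ {P : Pred ℕ 0ℓ} → Decidable P → ∀ {m q} → q < m → P q →
           ∃[ r ] (q ≤ r × r < m × P r × (∀ {s} → r < s → s < m → ¬ P s))
greatest P? {suc m} q<1+m Pq with P? m
... | yes Pm = m , ≤-pred q<1+m , ≤-refl , Pm , λ m<s s<1+m → ⊥-elim (<⇒≱ m<s (≤-pred s<1+m))
... | no ¬Pm with m≤n⇒m<n∨m≡n (≤-pred q<1+m)
...   | inj₂ refl = ⊥-elim (¬Pm Pq)
...   | inj₁ q<m with greatest P? q<m Pq
...     | r , q≤r , r<m , Pr , max = r , q≤r , m≤n⇒m≤1+n r<m , Pr , beyond
  where
  beyond : ∀ {s} → r < s → s < suc m → ¬ _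
  beyond {s} r<s s<1+m with m≤n⇒m<n∨m≡n (≤-pred s<1+m)
  ... | inj₁ s<m  = max r<s s<m
  ... | inj₂ refl = ¬Pm

-- Restricted growth functions

RG : (ℕ → ℕ) → ℕ → Set
RG f n = ∀ {p} → p < n → f p ≢ 0 → ∃[ q ] (q < p × suc (f q) ≡ f p)

IsRGF⇒RG : ∀ {n} (a : Vec ℕ n) → IsRGF a → RG (at a) n
IsRGF⇒RG a rgf p<n fp≢0
  with rgf (fromℕ< p<n) (λ e → fp≢0 (trans (sym (lookup-fromℕ< a p<n)) e))
... | j , j<p , e = toℕ j , subst (toℕ j <_) (toℕ-fromℕ< p<n) j<p ,
  trans (cong suc (sym (lookup≡at a j))) (trans e (lookup-fromℕ< a p<n))

RG⇒IsRGF : ∀ {n f} → RG f n → IsRGF (vec n f)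
RG⇒IsRGF {n} {f} rg i fi≢0 with rg (toℕ<n i) (λ e → fi≢0 (trans (lookup-vec n f i) e))
... | q , q<i , e = fromℕ< q<n , subst (_< toℕ i) (sym (toℕ-fromℕ< q<n)) q<i ,
  trans (cong suc (trans (lookup-vec n f (fromℕ< q<n)) (cong f (toℕ-fromℕ< q<n))))
        (trans e (sym (lookup-vec n f i)))
  where q<n = <-trans q<i (toℕ<n i)

Occurs : (ℕ → ℕ) → ℕ → ℕ → Set
Occurs f p v = ∃[ q ] (q < p × f q ≡ v)

occurs-downward : ∀ {f n p v w} → RG f n → p ≤ n → v ≤ w → Occurs f p w → Occurs f p v
occurs-downward {w = zero}  rg p≤n z≤n o = o
occurs-downward {f} {w = suc w} rg p≤n v≤1+w (q , q<p , fq≡1+w) with m≤n⇒m<n∨m≡n v≤1+w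
... | inj₂ refl = q , q<p , fq≡1+w
... | inj₁ v<1+w with rg (<-≤-trans q<p p≤n) (λ e → 0≢1+n (trans (sym e) fq≡1+w))
...   | r , r<q , e = occurs-downward rg p≤n (≤-pred v<1+w)
                        (r , <-trans r<q q<p , suc-injective (trans e fq≡1+w))

fresh-exceeds : ∀ {f n p v} → RG f n → p ≤ n → ¬ Occurs f p (f p) → Occurs f p v → v < f p
fresh-exceeds rg p≤n fresh o = ≰⇒> λ fp≤v → fresh (occurs-downward rg p≤n fp≤v o)

fresh-bounds : ∀ {f g n p} → RG f n → RG g n → p < n → ¬ Occurs f p (f p) →
               (∀ {v} → Occurs g p v → Occurs f p v) → g p ≤ f p
fresh-bounds {f} {g} {p = p} rf rg p<n fresh g⊆f with g p ≟ 0
... | yes gp≡0 = subst (_≤ f p) (sym gp≡0) z≤n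
... | no gp≢0 with rg p<n gp≢0
...   | q , q<p , e = subst (_≤ f p) e
                        (fresh-exceeds rf (<⇒≤ p<n) fresh (g⊆f (q , q<p , refl)))

SameKernel : (ℕ → ℕ) → (ℕ → ℕ) → ℕ → Set
SameKernel f g n = ∀ {p q} → p < n → q < n → f p ≡ f q → g p ≡ g q

-- A value not used before p is the least such value; every other value is forced by the kernel.
RG-unique : ∀ {f g n} → RG f n → RG g n → SameKernel f g n → SameKernel g f n →
            ∀ {p} → p < n → f p ≡ g p
RG-unique {f} {g} {n} rf rg fg gf = go (<-wellFounded _)
  where
  go : ∀ {p} → Acc _<_ p → p < n → f p ≡ g p
  go {p} (acc rs) p<n with anyUpTo? (λ q → f q ≟ f p) p
  ... | yes (q , q<p , fq≡fp) =
    trans (sym fq≡fp) (trans (go (rs q<p) (<-trans q<p p<n)) (fg (<-trans q<p p<n) p<n fq≡fp))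
  ... | no fresh-f = ≤-antisym (fresh-bounds rg rf p<n fresh-g f⊆g) (fresh-bounds rf rg p<n fresh-f g⊆f)
    where
    fresh-g : ¬ Occurs g p (g p)
    fresh-g (q , q<p , e) = fresh-f (q , q<p , gf (<-trans q<p p<n) p<n e)
    f⊆g : ∀ {v} → Occurs f p v → Occurs g p v
    f⊆g (q , q<p , e) = q , q<p , trans (sym (go (rs q<p) (<-trans q<p p<n))) e
    g⊆f : ∀ {v} → Occurs g p v → Occurs f p v
    g⊆f (q , q<p , e) = q , q<p , trans (go (rs q<p) (<-trans q<p p<n)) e

-- Arcs; indecomposable noncrossing nonnesting partitions are combs

record IsArc (f : ℕ → ℕ) (n i j : ℕ) : Set where
  field
    start<end    : i < j
    end<n        : j < n
    same-block   : f i ≡ f j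
    none-between : ∀ {k} → i < k → k < j → f k ≢ f i

  start<n : i < n
  start<n = <-trans start<end end<n

open IsArc

Arc⇒IsArc : ∀ {n} (a : Vec ℕ n) {i j} → Arc a i j → IsArc (at a) n (toℕ i) (toℕ j)
Arc⇒IsArc a {i} {j} (i<j , e , between) = record
  { start<end = i<j
  ; end<n = toℕ<n j
  ; same-block = trans (sym (lookup≡at a i)) (trans e (lookup≡at a j))
  ; none-between = λ {k} i<k k<j e′ →
      let k<n = <-trans k<j (toℕ<n j) in
      between (fromℕ< k<n)
        (subst (toℕ i <_) (sym (toℕ-fromℕ< k<n)) i<k)
        (subst (_< toℕ j) (sym (toℕ-fromℕ< k<n)) k<j)
        (trans (lookup-fromℕ< a k<n) (trans e′ (sym (lookup≡at a i))))
  }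

IsArc⇒Arc : ∀ {n} (a : Vec ℕ n) {i j} → IsArc (at a) n (toℕ i) (toℕ j) → Arc a i j
IsArc⇒Arc a {i} {j} arc =
  start<end arc ,
  trans (lookup≡at a i) (trans (same-block arc) (sym (lookup≡at a j))) ,
  λ k i<k k<j e → none-between arc i<k k<j
                    (trans (sym (lookup≡at a k)) (trans e (lookup≡at a i)))

fromℕ<-IsArc : ∀ {n} (a : Vec ℕ n) {i j} (arc : IsArc (at a) n i j) →
               Arc a (fromℕ< (start<n arc)) (fromℕ< (end<n arc))
fromℕ<-IsArc a arc = IsArc⇒Arc a
  (subst₂ (IsArc (at a) _) (sym (toℕ-fromℕ< (start<n arc))) (sym (toℕ-fromℕ< (end<n arc))) arc)

fromℕ<-mono : ∀ {n p q} .(p<n : p < n) .(q<n : q < n) → p < q → fromℕ< p<n ⟨<⟩ fromℕ< q<n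
fromℕ<-mono p<n q<n = subst₂ _<_ (sym (toℕ-fromℕ< p<n)) (sym (toℕ-fromℕ< q<n))

NoncrossingN : (ℕ → ℕ) → ℕ → Set
NoncrossingN f n = ∀ {i₁ j₁ i₂ j₂} → IsArc f n i₁ j₁ → IsArc f n i₂ j₂ →
                   ¬ (i₁ < i₂ × i₂ < j₁ × j₁ < j₂)

NonnestingN : (ℕ → ℕ) → ℕ → Set
NonnestingN f n = ∀ {i₁ j₁ i₂ j₂} → IsArc f n i₁ j₁ → IsArc f n i₂ j₂ →
                  ¬ (i₁ < i₂ × i₂ < j₂ × j₂ < j₁)

Noncrossing⇒N : ∀ {n} (a : Vec ℕ n) → Noncrossing a → NoncrossingN (at a) n
Noncrossing⇒N a nc arc₁ arc₂ (i₁<i₂ , i₂<j₁ , j₁<j₂) =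
  nc _ _ _ _ (fromℕ<-IsArc a arc₁) (fromℕ<-IsArc a arc₂)
    ( fromℕ<-mono (start<n arc₁) (start<n arc₂) i₁<i₂
    , fromℕ<-mono (start<n arc₂) (end<n arc₁) i₂<j₁
    , fromℕ<-mono (end<n arc₁) (end<n arc₂) j₁<j₂ )

Nonnesting⇒N : ∀ {n} (a : Vec ℕ n) → Nonnesting a → NonnestingN (at a) n
Nonnesting⇒N a nn arc₁ arc₂ (i₁<i₂ , i₂<j₂ , j₂<j₁) =
  nn _ _ _ _ (fromℕ<-IsArc a arc₁) (fromℕ<-IsArc a arc₂)
    ( fromℕ<-mono (start<n arc₁) (start<n arc₂) i₁<i₂
    , fromℕ<-mono (start<n arc₂) (end<n arc₂) i₂<j₂
    , fromℕ<-mono (end<n arc₂) (end<n arc₁) j₂<j₁ )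

arc-to-next : ∀ {f n p q} → p < q → q < n → f p ≡ f q → ∃[ r ] IsArc f n p r
arc-to-next {f} {n} {p} p<q q<n fp≡fq
  with least (λ r → (p <? r) ×-dec (f r ≟ f p)) (p<q , sym fp≡fq)
... | r , r≤q , (p<r , fr≡fp) , first = r , record
  { start<end = p<r
  ; end<n = ≤-<-trans r≤q q<n
  ; same-block = sym fr≡fp
  ; none-between = λ p<k k<r fk≡fp → first k<r (p<k , fk≡fp)
  }

Straddled : (ℕ → ℕ) → ℕ → ℕ → Set
Straddled f n g = ∃[ i ] ∃[ j ] (i ≤ g × g < j × IsArc f n i j)

straddled-by-arc : ∀ {f n g i j} → i ≤ g → g < j → j < n → f i ≡ f j → Straddled f n g
straddled-by-arc {f} {n} {g} {i} {j} i≤g g<j j<n fi≡fj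
  with greatest (λ r → f r ≟ f i) (s≤s i≤g) refl
... | i′ , _ , i′<1+g , fi′≡fi , last
  with arc-to-next {f} (≤-<-trans (≤-pred i′<1+g) g<j) j<n (trans fi′≡fi fi≡fj)
...   | r , arc = i′ , r , ≤-pred i′<1+g , ≰⇒> r≰g , arc
  where
  r≰g : ¬ r ≤ g
  r≰g r≤g = last (start<end arc) (s≤s r≤g) (trans (sym (same-block arc)) fi′≡fi)

Indecomposable⇒straddled : ∀ {n} (a : Vec ℕ n) → Indecomposable a →
                           ∀ {g} → suc g < n → Straddled (at a) n g
Indecomposable⇒straddled {n} a ind {g} 1+g<n
  with anyUpTo? (λ i → anyUpTo? (λ j → (g <? j) ×-dec (at a i ≟ at a j)) n) (suc g)
... | yes (i , i<1+g , j , j<n , g<j , e) = straddled-by-arc (≤-pred i<1+g) g<j j<n e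
... | no none = ⊥-elim (ind (suc g) (s≤s z≤n) 1+g<n (map (at a) (upTo (suc g)) , blocks))
  where
  blocks : BlocksPartition a (map (at a) (upTo (suc g))) (suc g)
  blocks i = mk⇔ (λ lt → subst (_∈ _) (sym (lookup≡at a i)) (∈-map⁺ (at a) (∈-upTo⁺ lt))) from
    where
    from : lookup a i ∈ map (at a) (upTo (suc g)) → toℕ i < suc g
    from m with ∈-map⁻ (at a) m | toℕ i <? suc g
    ... | _           | yes lt = lt
    ... | q , q∈ , e | no i≮1+g = ⊥-elim (none (q , ∈-upTo⁻ q∈ , toℕ i , toℕ<n i ,
                                    ≤-pred (≰⇒> i≮1+g) , trans (sym e) (lookup≡at a i)))

overlapping-arcs-same-block : ∀ {f n} → NoncrossingN f n → NonnestingN f n → ∀ {i₁ j₁ i₂ j₂} →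
  IsArc f n i₁ j₁ → IsArc f n i₂ j₂ → i₁ < i₂ → i₂ < j₁ → f i₁ ≡ f i₂
overlapping-arcs-same-block {f} nc nn {j₁ = j₁} {j₂ = j₂} arc₁ arc₂ i₁<i₂ i₂<j₁ with <-cmp j₁ j₂
... | tri< j₁<j₂ _ _ = ⊥-elim (nc arc₁ arc₂ (i₁<i₂ , i₂<j₁ , j₁<j₂))
... | tri> _ _ j₂<j₁ = ⊥-elim (nn arc₁ arc₂ (i₁<i₂ , start<end arc₂ , j₂<j₁))
... | tri≈ _ j₁≡j₂ _ = trans (same-block arc₁) (trans (cong f j₁≡j₂) (sym (same-block arc₂)))

same-gap : ∀ {f n} → NoncrossingN f n → NonnestingN f n → ∀ {g i₁ j₁ i₂ j₂} →
           IsArc f n i₁ j₁ → IsArc f n i₂ j₂ → i₁ ≤ g → g < j₁ → i₂ ≤ g → g < j₂ → f i₁ ≡ f i₂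
same-gap {f} nc nn {i₁ = i₁} {i₂ = i₂} arc₁ arc₂ i₁≤g g<j₁ i₂≤g g<j₂ with <-cmp i₁ i₂
... | tri≈ _ i₁≡i₂ _ = cong f i₁≡i₂
... | tri< i₁<i₂ _ _ = overlapping-arcs-same-block nc nn arc₁ arc₂ i₁<i₂ (≤-<-trans i₂≤g g<j₁)
... | tri> _ _ i₂<i₁ = sym (overlapping-arcs-same-block nc nn arc₂ arc₁ i₂<i₁ (≤-<-trans i₁≤g g<j₂))

RG-first : ∀ {f n} → RG f n → 0 < n → f 0 ≡ 0
RG-first {f} rg 0<n with f 0 ≟ 0
... | yes f0≡0 = f0≡0
... | no f0≢0 with rg 0<n f0≢0
...   | _ , () , _

-- By induction on the left end i: an arc over the gap before i lies in block 0, and it either ends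
-- at i or also spans the gap after i.
arcs-in-block-0 : ∀ {f n} → RG f n → NoncrossingN f n → NonnestingN f n →
                  (∀ {g} → suc g < n → Straddled f n g) → ∀ {i j} → IsArc f n i j → f i ≡ 0
arcs-in-block-0 {f} {n} rg nc nn straddled = go (<-wellFounded _)
  where
  go : ∀ {i j} → Acc _<_ i → IsArc f n i j → f i ≡ 0
  go {zero}  _        arc = RG-first rg (start<n arc)
  go {suc g} (acc rs) arc with straddled (start<n arc)
  ... | i′ , j′ , i′≤g , g<j′ , arc′ with m≤n⇒m<n∨m≡n g<j′
  ...   | inj₂ 1+g≡j′ = trans (cong f 1+g≡j′) (trans (sym (same-block arc′)) (go (rs (s≤s i′≤g)) arc′))
  ...   | inj₁ 1+g<j′ = trans (same-gap nc nn arc arc′ ≤-refl (start<end arc) (m≤n⇒m≤1+n i′≤g) 1+g<j′)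
                              (go (rs (s≤s i′≤g)) arc′)

record Comb (f : ℕ → ℕ) (n : ℕ) : Set where
  field
    rg         : RG f n
    repeated≡0 : ∀ {p q} → p < n → q < n → p ≢ q → f p ≡ f q → f p ≡ 0
    last≡0     : ∀ {p} → suc p ≡ n → f p ≡ 0

open Comb

Comb-resp : ∀ {f g n} → (∀ {p} → p < n → f p ≡ g p) → Comb f n → Comb g n
Comb-resp {f} {g} {n} f≡g comb = record
  { rg = λ {p} p<n gp≢0 →
      let q , q<p , e = rg comb p<n (λ fp≡0 → gp≢0 (trans (sym (f≡g p<n)) fp≡0)) in
      q , q<p , trans (cong suc (sym (f≡g (<-trans q<p p<n)))) (trans e (f≡g p<n))
  ; repeated≡0 = λ p<n q<n p≢q gp≡gq → trans (sym (f≡g p<n))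
      (repeated≡0 comb p<n q<n p≢q (trans (f≡g p<n) (trans gp≡gq (sym (f≡g q<n)))))
  ; last≡0 = λ 1+p≡n → trans (sym (f≡g (subst (_ <_) 1+p≡n ≤-refl))) (last≡0 comb 1+p≡n)
  }

Pincn⇒Comb : ∀ {n} (a : Vec ℕ n) → IsRGF a → Indecomposable a × Noncrossing a × Nonnesting a →
             Comb (at a) n
Pincn⇒Comb {n} a rgf (ind , nc , nn) = record { rg = rg′ ; repeated≡0 = repeated ; last≡0 = last }
  where
  rg′ : RG (at a) n
  rg′ = IsRGF⇒RG a rgf
  straddled : ∀ {g} → suc g < n → Straddled (at a) n g
  straddled = Indecomposable⇒straddled a ind
  block0 : ∀ {i j} → IsArc (at a) n i j → at a i ≡ 0
  block0 = arcs-in-block-0 rg′ (Noncrossing⇒N a nc) (Nonnesting⇒N a nn) straddled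

  repeated : ∀ {p q} → p < n → q < n → p ≢ q → at a p ≡ at a q → at a p ≡ 0
  repeated {p} {q} p<n q<n p≢q e with <-cmp p q
  ... | tri< p<q _ _ = block0 (proj₂ (arc-to-next p<q q<n e))
  ... | tri≈ _ p≡q _ = ⊥-elim (p≢q p≡q)
  ... | tri> _ _ q<p = trans e (block0 (proj₂ (arc-to-next q<p p<n (sym e))))

  last : ∀ {p} → suc p ≡ n → at a p ≡ 0
  last {zero}  1≡n = RG-first rg′ (subst (0 <_) 1≡n (s≤s z≤n))
  last {suc g} e with straddled (subst (suc (suc g) ≤_) e ≤-refl)
  ... | i , j , i≤g , g<j , arc =
    trans (cong (at a) (≤-antisym g<j j≤1+g)) (trans (sym (same-block arc)) (block0 arc))
    where
    j≤1+g : j ≤ suc g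
    j≤1+g = ≤-pred (subst (j <_) (sym e) (end<n arc))

module _ {n} (a : Vec ℕ n) (comb : Comb (at a) n) where

  private
    arc-in-block-0 : ∀ {i j} → Arc a i j → lookup a i ≡ 0
    arc-in-block-0 {i} A = trans (lookup≡at a i)
      (repeated≡0 comb (start<n arc) (end<n arc) (<⇒≢ (start<end arc)) (same-block arc))
      where arc = Arc⇒IsArc a A

  Comb⇒Noncrossing : Noncrossing a
  Comb⇒Noncrossing i₁ j₁ i₂ j₂ A₁ A₂ (i₁<i₂ , i₂<j₁ , _) =
    proj₂ (proj₂ A₁) i₂ i₁<i₂ i₂<j₁ (trans (arc-in-block-0 A₂) (sym (arc-in-block-0 A₁)))

  Comb⇒Nonnesting : Nonnesting a
  Comb⇒Nonnesting i₁ j₁ i₂ j₂ A₁ A₂ (i₁<i₂ , i₂<j₂ , j₂<j₁) =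
    proj₂ (proj₂ A₁) i₂ i₁<i₂ (<-trans i₂<j₂ j₂<j₁) (trans (arc-in-block-0 A₂) (sym (arc-in-block-0 A₁)))

Comb⇒Indecomposable : ∀ {n} (a : Vec ℕ n) → Comb (at a) n → Indecomposable a
Comb⇒Indecomposable {zero}  a comb k 1≤k ()
Comb⇒Indecomposable {suc m} a comb k 1≤k k<1+m (S , blocks) =
  <⇒≱ k<1+m (subst (_< k) (toℕ-fromℕ m) (Equivalence.from (blocks (fromℕ m)) last∈S))
  where
  first∈S : 0 ∈ S
  first∈S = subst (_∈ S) (trans (lookup≡at a Fin.zero) (RG-first (rg comb) (s≤s z≤n)))
              (Equivalence.to (blocks Fin.zero) 1≤k)
  last∈S : lookup a (fromℕ m) ∈ S
  last∈S = subst (_∈ S) (sym (trans (lookup≡at a (fromℕ m)) (last≡0 comb (cong suc (toℕ-fromℕ m)))))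
             first∈S

-- Combs are coded by their inner singletons

bit : Bool → ℕ
bit false = 0
bit true  = 1

bit≤1 : ∀ b → bit b ≤ 1
bit≤1 false = z≤n
bit≤1 true  = ≤-refl

count : (ℕ → Bool) → ℕ → ℕ
count β zero    = 0
count β (suc p) = bit (β (suc p)) + count β p

count-mono : ∀ β {p q} → p ≤ q → count β p ≤ count β q
count-mono β {q = zero}  z≤n  = ≤-refl
count-mono β {q = suc q} p≤1+q with m≤n⇒m<n∨m≡n p≤1+q
... | inj₂ refl  = ≤-refl
... | inj₁ p<1+q = ≤-trans (count-mono β (≤-pred p<1+q)) (m≤n+m (count β q) (bit (β (suc q))))

count-cong : ∀ {β γ} p → (∀ {q} → 0 < q → q ≤ p → β q ≡ γ q) → count β p ≡ count γ p
count-cong zero    eq = refl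
count-cong (suc p) eq = cong₂ (λ b c → bit b + c) (eq (s≤s z≤n) ≤-refl)
                          (count-cong p λ 0<q q≤p → eq 0<q (m≤n⇒m≤1+n q≤p))

count-true : ∀ {β} p → β (suc p) ≡ true → count β (suc p) ≡ suc (count β p)
count-true p βp rewrite βp = refl

count-strict : ∀ {β p q} → p < q → β q ≡ true → count β p < count β q
count-strict {β} {p} {suc q} (s≤s p≤q) βq =
  subst (count β p <_) (sym (count-true q βq)) (s≤s (count-mono β p≤q))

last-true : ∀ {β} r {m} → count β r ≡ suc m → ∃[ q ] (0 < q × q ≤ r × β q ≡ true × count β q ≡ suc m)
last-true {β} (suc r) e with β (suc r) in βr
... | true  = suc r , s≤s z≤n , ≤-refl , βr , trans (count-true r βr) e
... | false with last-true r e
...   | q , 0<q , q≤r , βq , cq = q , 0<q , m≤n⇒m≤1+n q≤r , βq , cq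

-- The positions 2, …, n − 1 of the paper.
Inner : ℕ → ℕ → Set
Inner n p = 0 < p × suc p < n

inner? : ∀ n p → Dec (Inner n p)
inner? n p = (0 <? p) ×-dec (suc p <? n)

isNo-≡ : ∀ {x y : ℕ} → x ≡ y → isNo (x ≟ y) ≡ false
isNo-≡ {x} {y} x≡y with x ≟ y
... | yes _   = refl
... | no x≢y = ⊥-elim (x≢y x≡y)

isNo-≢ : ∀ {x y : ℕ} → x ≢ y → isNo (x ≟ y) ≡ true
isNo-≢ {x} {y} x≢y with x ≟ y
... | yes x≡y = ⊥-elim (x≢y x≡y)
... | no _    = refl

singletons : (ℕ → ℕ) → ℕ → Bool
singletons f p = isNo (f p ≟ 0)

combOf : ℕ → (ℕ → Bool) → ℕ → ℕ
combOf n γ p = if isYes (inner? n p) ∧ γ p then count γ p else 0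

combOf-true : ∀ {n γ p} → Inner n p → γ p ≡ true → combOf n γ p ≡ count γ p
combOf-true {n} {γ} {p} inner γp with inner? n p
... | yes _      rewrite γp = refl
... | no ¬inner = ⊥-elim (¬inner inner)

combOf-false : ∀ {n γ p} → γ p ≡ false → combOf n γ p ≡ 0
combOf-false {n} {γ} {p} γp with inner? n p
... | yes _ rewrite γp = refl
... | no _  = refl

combOf-outer : ∀ {n} γ p → ¬ Inner n p → combOf n γ p ≡ 0
combOf-outer {n} γ p ¬inner with inner? n p
... | yes inner = ⊥-elim (¬inner inner)
... | no _      = refl

combOf-≢0 : ∀ {n} γ p → combOf n γ p ≢ 0 → Inner n p × γ p ≡ true
combOf-≢0 {n} γ p ne with inner? n p | γ p
... | yes inner | true  = inner , refl
... | yes _     | false = ⊥-elim (ne refl)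
... | no _      | _     = ⊥-elim (ne refl)

count-true≢0 : ∀ {γ p} → 0 < p → γ p ≡ true → count γ p ≢ 0
count-true≢0 {p = suc p} _ γp e = 0≢1+n (trans (sym e) (count-true p γp))

combOf-cong : ∀ {n β γ} → (∀ {q} → Inner n q → β q ≡ γ q) → ∀ p → combOf n β p ≡ combOf n γ p
combOf-cong {n} {β} {γ} eq p with inner? n p
... | yes (0<p , 1+p<n) = cong₂ (λ b c → if b then c else 0) (eq (0<p , 1+p<n))
                            (count-cong p λ 0<q q≤p → eq (0<q , ≤-<-trans (s≤s q≤p) 1+p<n))
... | no _ = refl

combOf-Comb : ∀ n γ → Comb (combOf n γ) n
combOf-Comb n γ = record { rg = rg′ ; repeated≡0 = repeated ; last≡0 = last }
  where
  rg′ : RG (combOf n γ) n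
  rg′ {zero}  _ ne = ⊥-elim (ne refl)
  rg′ {suc p} _ ne = predecessor (count γ p) refl
    where
    inner : Inner n (suc p)
    inner = proj₁ (combOf-≢0 γ (suc p) ne)
    γp : γ (suc p) ≡ true
    γp = proj₂ (combOf-≢0 γ (suc p) ne)
    value : combOf n γ (suc p) ≡ suc (count γ p)
    value = trans (combOf-true inner γp) (count-true p γp)
    predecessor : ∀ c → count γ p ≡ c → ∃[ q ] (q < suc p × suc (combOf n γ q) ≡ combOf n γ (suc p))
    predecessor zero    cp = 0 , s≤s z≤n , sym (trans value (cong suc cp))
    predecessor (suc m) cp with last-true p cp
    ... | q , 0<q , q≤p , γq , cq = q , s≤s q≤p ,
      trans (cong suc (trans (combOf-true (0<q , q+1<n) γq) cq)) (sym (trans value (cong suc cp)))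
      where q+1<n = ≤-<-trans (s≤s q≤p) (<-trans (n<1+n _) (proj₂ inner))

  repeated : ∀ {p q} → p < n → q < n → p ≢ q → combOf n γ p ≡ combOf n γ q → combOf n γ p ≡ 0
  repeated {p} {q} _ _ p≢q e with combOf n γ p ≟ 0
  ... | yes cp≡0 = cp≡0
  ... | no cp≢0 with combOf-≢0 γ p cp≢0 | combOf-≢0 γ q (λ cq≡0 → cp≢0 (trans e cq≡0))
  ...   | ip , γp | iq , γq with <-cmp p q
  ...     | tri< p<q _ _ = ⊥-elim (<-irrefl counts≡ (count-strict p<q γq))
    where counts≡ = trans (sym (combOf-true ip γp)) (trans e (combOf-true iq γq))
  ...     | tri≈ _ p≡q _ = ⊥-elim (p≢q p≡q)
  ...     | tri> _ _ q<p = ⊥-elim (<-irrefl counts≡ (count-strict q<p γp))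
    where counts≡ = trans (sym (combOf-true iq γq)) (trans (sym e) (combOf-true ip γp))

  last : ∀ {p} → suc p ≡ n → combOf n γ p ≡ 0
  last {p} 1+p≡n = combOf-outer γ p λ (_ , 1+p<n) → <-irrefl 1+p≡n 1+p<n

singletons-combOf : ∀ {n γ p} → Inner n p → singletons (combOf n γ) p ≡ γ p
singletons-combOf {n} {γ} {p} inner = by-value (γ p) refl
  where
  by-value : ∀ b → γ p ≡ b → singletons (combOf n γ) p ≡ b
  by-value true  γp = isNo-≢ λ e →
    count-true≢0 (proj₁ inner) γp (trans (sym (combOf-true inner γp)) e)
  by-value false γp = isNo-≡ (combOf-false {n} {γ} γp)

Comb-boundary : ∀ {f n p} → Comb f n → p < n → ¬ Inner n p → f p ≡ 0
Comb-boundary {p = zero}  comb p<n _ = RG-first (rg comb) p<n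
Comb-boundary {p = suc p} comb p<n ¬inner =
  last≡0 comb (≤-antisym p<n (≮⇒≥ λ 2+p<n → ¬inner (s≤s z≤n , 2+p<n)))

Comb-kernel : ∀ {f g n} → Comb f n → Comb g n → (∀ {p} → p < n → f p ≡ 0 → g p ≡ 0) →
              SameKernel f g n
Comb-kernel {f} {g} combf combg zeros {p} {q} p<n q<n fp≡fq with p ≟ q
... | yes refl = refl
... | no p≢q = trans (zeros p<n fp≡0) (sym (zeros q<n (trans (sym fp≡fq) fp≡0)))
  where fp≡0 = repeated≡0 combf p<n q<n p≢q fp≡fq

combOf-singletons : ∀ {f n} → Comb f n → ∀ {p} → p < n → combOf n (singletons f) p ≡ f p
combOf-singletons {f} {n} comb =
  RG-unique (rg comb′) (rg comb) (Comb-kernel comb′ comb zeros⁻) (Comb-kernel comb comb′ zeros⁺)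
  where
  comb′ = combOf-Comb n (singletons f)
  zeros⁺ : ∀ {p} → p < n → f p ≡ 0 → combOf n (singletons f) p ≡ 0
  zeros⁺ {p} _ fp≡0 = combOf-false {n} {singletons f} (isNo-≡ fp≡0)
  zeros⁻ : ∀ {p} → p < n → combOf n (singletons f) p ≡ 0 → f p ≡ 0
  zeros⁻ {p} p<n cp≡0 = by-position (inner? n p)
    where
    by-position : Dec (Inner n p) → f p ≡ 0
    by-position (no ¬inner) = Comb-boundary comb p<n ¬inner
    by-position (yes inner) = decidable-stable (f p ≟ 0) λ fp≢0 →
      count-true≢0 (proj₁ inner) (isNo-≢ fp≢0)
        (trans (sym (combOf-true inner (isNo-≢ fp≢0))) cp≡0)

-- Mountains

Descent Ascent : (ℕ → ℕ) → ℕ → Set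
Descent d i = d (suc i) < d i
Ascent  d i = d i < d (suc i)

record Mountain (d : ℕ → ℕ) (n : ℕ) : Set where
  field
    first≡0   : d 0 ≡ 0
    last≡0    : ∀ {p} → suc p ≡ n → d p ≡ 0
    step-up   : ∀ {i} → suc i < n → d (suc i) ≤ suc (d i)
    step-down : ∀ {i} → suc i < n → d i ≤ suc (d (suc i))
    unimodal  : ∀ {i j} → i < j → suc j < n → Descent d i → ¬ Ascent d j

open Mountain

step-between : ∀ {R : ℕ → ℕ → Set} → (∀ x y → Dec (R x y)) →
               (∀ {x y z} → ¬ R y z → R x z → R x y) →
               ∀ (f : ℕ → ℕ) {p q} → p < q → R (f p) (f q) →
               ∃[ i ] (p ≤ i × i < q × R (f i) (f (suc i)))
step-between R? shift f {p} {suc q} p<1+q Rpq with R? (f q) (f (suc q))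
... | yes Rq = q , ≤-pred p<1+q , ≤-refl , Rq
... | no ¬Rq with m≤n⇒m<n∨m≡n (≤-pred p<1+q)
...   | inj₂ refl = ⊥-elim (¬Rq Rpq)
...   | inj₁ p<q with step-between R? shift f p<q (shift ¬Rq Rpq)
...     | i , p≤i , i<q , Ri = i , p≤i , m≤n⇒m≤1+n i<q , Ri

descent-between : ∀ d {p q} → p < q → d q < d p → ∃[ i ] (p ≤ i × i < q × Descent d i)
descent-between = step-between (λ x y → y <? x) λ ¬z<y z<x → ≤-<-trans (≮⇒≥ ¬z<y) z<x

ascent-between : ∀ d {p q} → p < q → d p < d q → ∃[ i ] (p ≤ i × i < q × Ascent d i)
ascent-between = step-between _<?_ λ ¬y<z x<z → <-≤-trans x<z (≮⇒≥ ¬y<z)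

superlevel-convex : ∀ {d n t s q e} → Mountain d n → s ≤ q → q ≤ e → e < n →
                    t < d s → t < d e → t < d q
superlevel-convex {d} {n} {t} {s} {q} {e} mountain s≤q q≤e e<n t<ds t<de with t <? d q
... | yes t<dq = t<dq
... | no t≮dq with descent-between d s<q (≤-<-trans dq≤t t<ds) | ascent-between d q<e (≤-<-trans dq≤t t<de)
  where
  dq≤t = ≮⇒≥ t≮dq
  s<q : s < q
  s<q = ≤∧≢⇒< s≤q λ { refl → t≮dq t<ds }
  q<e : q < e
  q<e = ≤∧≢⇒< q≤e λ { refl → t≮dq t<de }
...   | i , _ , i<q , descent | j , q≤j , j<e , ascent =
  ⊥-elim (unimodal mountain (<-≤-trans i<q q≤j) (≤-<-trans j<e e<n) descent ascent)

mountain-attains : ∀ {d n} → Mountain d n → ∀ {p v} → p < n → v < d p → ∃[ q ] (q < p × d q ≡ v)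
mountain-attains mountain {zero} _ v<d0 = ⊥-elim (n≮0 (subst (_ <_) (first≡0 mountain) v<d0))
mountain-attains {d} mountain {suc p} 1+p<n v<dp
  with m≤n⇒m<n∨m≡n (≤-pred (≤-trans v<dp (step-up mountain 1+p<n)))
... | inj₂ v≡dp = p , ≤-refl , sym v≡dp
... | inj₁ v<dp′ with mountain-attains mountain (<-trans (n<1+n p) 1+p<n) v<dp′
...   | q , q<p , dq≡v = q , m≤n⇒m≤1+n q<p , dq≡v

Mountain⇒RG : ∀ {d n} → Mountain d n → RG d n
Mountain⇒RG {d} mountain {p} p<n dp≢0 with d p in dp
... | zero  = ⊥-elim (dp≢0 refl)
... | suc v with mountain-attains mountain p<n (subst (v <_) (sym dp) ≤-refl)
...   | q , q<p , dq≡v = q , q<p , cong suc dq≡v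

Mountain-resp : ∀ {d e n} → 0 < n → (∀ {p} → p < n → d p ≡ e p) → Mountain d n → Mountain e n
Mountain-resp {d} {e} {n} 0<n d≡e mountain = record
  { first≡0   = trans (sym (d≡e 0<n)) (first≡0 mountain)
  ; last≡0    = λ 1+p≡n → trans (sym (d≡e (subst (_ <_) 1+p≡n ≤-refl))) (last≡0 mountain 1+p≡n)
  ; step-up   = λ 1+i<n → subst₂ (λ x y → x ≤ suc y) (d≡e 1+i<n) (d≡e (<-trans (n<1+n _) 1+i<n))
                            (step-up mountain 1+i<n)
  ; step-down = λ 1+i<n → subst₂ (λ x y → y ≤ suc x) (d≡e 1+i<n) (d≡e (<-trans (n<1+n _) 1+i<n))
                            (step-down mountain 1+i<n)
  ; unimodal  = λ {i} {j} i<j 1+j<n descent ascent →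
      let 1+i<n = ≤-<-trans (s≤s (<⇒≤ i<j)) 1+j<n in
      unimodal mountain i<j 1+j<n
        (subst₂ _<_ (sym (d≡e 1+i<n)) (sym (d≡e (<-trans (n<1+n i) 1+i<n))) descent)
        (subst₂ _<_ (sym (d≡e (<-trans (n<1+n j) 1+j<n))) (sym (d≡e 1+j<n)) ascent)
  }

record Enclosure (d : ℕ → ℕ) (n t : ℕ) : Set where
  field
    left right   : ℕ
    left<right   : left < right
    right<n      : right < n
    left-level   : d left ≡ t
    right-level  : d right ≡ t
    above⇒inside : ∀ {p} → p < n → t < d p → left < p × p < right
    inside⇒above : ∀ {p} → left < p → p < right → t < d p

  arc : IsArc d n left right
  arc = record
    { start<end = left<right
    ; end<n = right<n
    ; same-block = trans left-level (sym right-level)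
    ; none-between = λ left<k k<right dk≡dleft →
        <-irrefl (sym (trans dk≡dleft left-level)) (inside⇒above left<k k<right)
    }

  entry : ∀ {p} → left < suc p → suc p < right → ¬ t < d p → left ≡ p
  entry {p} left<1+p 1+p<right ¬above = ≤-antisym (≤-pred left<1+p) (≮⇒≥ λ left<p →
    ¬above (inside⇒above left<p (<-trans (n<1+n p) 1+p<right)))

  exit : ∀ {p} → left < p → p < right → ¬ t < d (suc p) → right ≡ suc p
  exit {p} left<p p<right ¬above = ≤-antisym (≮⇒≥ λ 1+p<right →
    ¬above (inside⇒above (<-trans left<p (n<1+n p)) 1+p<right)) p<right

open Enclosure

mountain-enclosure : ∀ {d n} → Mountain d n → ∀ {t p} → p < n → t < d p → Enclosure d n t
mountain-enclosure {d} {n} mountain {t} {p} p<n t<dp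
  with least (λ q → t <? d q) t<dp | greatest (λ q → t <? d q) p<n t<dp
... | zero  , _ , t<d0 , _ | _ = ⊥-elim (n≮0 (subst (t <_) (first≡0 mountain) t<d0))
... | suc s , 1+s≤p , t<ds , first | e , p≤e , e<n , t<de , last = record
  { left = s
  ; right = suc e
  ; left<right = s≤s (≤-trans (≤-trans (n≤1+n s) 1+s≤p) p≤e)
  ; right<n = 1+e<n
  ; left-level = ≤-antisym (≮⇒≥ (first ≤-refl))
                   (≤-pred (≤-trans t<ds (step-up mountain (≤-<-trans 1+s≤p p<n))))
  ; right-level = ≤-antisym (≮⇒≥ (last (n<1+n e) 1+e<n)) (≤-pred (≤-trans t<de (step-down mountain 1+e<n)))
  ; above⇒inside = λ q<n t<dq → ≮⇒≥ (λ q<1+s → first q<1+s t<dq) , s≤s (≮⇒≥ λ e<q → last e<q q<n t<dq)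
  ; inside⇒above = λ s<q q<1+e → superlevel-convex mountain s<q (≤-pred q<1+e) e<n t<ds t<de
  }
  where
  1+e<n : suc e < n
  1+e<n = ≤∧≢⇒< e<n λ 1+e≡n → <-irrefl (sym (last≡0 mountain 1+e≡n)) (≤-<-trans z≤n t<de)

-- A descent at i closes the enclosure of level d (i + 1) at i + 1 and an ascent at j opens that of
-- level d j at j; the enclosure of the lower level would contain the other position.
enclosures⇒unimodal : ∀ {d n} → (∀ {t p} → p < n → t < d p → Enclosure d n t) →
                      ∀ {i j} → i < j → suc j < n → Descent d i → ¬ Ascent d j
enclosures⇒unimodal {d} enclosure {i} {j} i<j 1+j<n descent ascent = by-heights (d (suc i) ≤? d j)
  where
  1+i<n = ≤-<-trans (s≤s (<⇒≤ i<j)) 1+j<n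
  i<n   = <-trans (n<1+n i) 1+i<n
  E₁    = enclosure i<n descent
  E₂    = enclosure 1+j<n ascent
  l₁<i  = proj₁ (above⇒inside E₁ i<n descent)
  i<r₁  = proj₂ (above⇒inside E₁ i<n descent)
  l₂<1+j = proj₁ (above⇒inside E₂ 1+j<n ascent)
  1+j<r₂ = proj₂ (above⇒inside E₂ 1+j<n ascent)
  by-heights : Dec (d (suc i) ≤ d j) → ⊥
  by-heights (yes d1+i≤dj) = <-asym i<j (≤-pred (subst (suc j <_) (exit E₁ l₁<i i<r₁ (n≮n _))
                            (proj₂ (above⇒inside E₁ 1+j<n (≤-<-trans d1+i≤dj ascent)))))
  by-heights (no d1+i≰dj) = <⇒≱ i<j (≤-pred (subst (_< suc i) (entry E₂ l₂<1+j 1+j<r₂ (n≮n _))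
                           (proj₁ (above⇒inside E₂ 1+i<n (≰⇒> d1+i≰dj)))))

enclosures⇒Mountain : ∀ {d n} → 0 < n → (∀ {t p} → p < n → t < d p → Enclosure d n t) → Mountain d n
enclosures⇒Mountain {d} {n} 0<n enclosure = record
  { first≡0   = n≤0⇒n≡0 (≮⇒≥ λ 0<d0 → n≮0 (proj₁ (above⇒inside (enclosure 0<n 0<d0) 0<n 0<d0)))
  ; last≡0    = last
  ; step-up   = up
  ; step-down = down
  ; unimodal  = enclosures⇒unimodal enclosure
  }
  where
  last : ∀ {p} → suc p ≡ n → d p ≡ 0
  last {p} 1+p≡n = n≤0⇒n≡0 (≮⇒≥ λ 0<dp →
    let E = enclosure p<n 0<dp in
    <⇒≱ (proj₂ (above⇒inside E p<n 0<dp)) (≤-pred (subst (right E <_) (sym 1+p≡n) (right<n E))))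
    where p<n = subst (p <_) 1+p≡n ≤-refl

  up : ∀ {i} → suc i < n → d (suc i) ≤ suc (d i)
  up {i} 1+i<n = ≮⇒≥ λ above →
    let E = enclosure 1+i<n above
        l<1+i , 1+i<r = above⇒inside E 1+i<n above in
    1+n≢n (sym (trans (cong d (sym (entry E l<1+i 1+i<r (≤⇒≯ (n≤1+n _))))) (left-level E)))

  down : ∀ {i} → suc i < n → d i ≤ suc (d (suc i))
  down {i} 1+i<n = ≮⇒≥ λ above →
    let E = enclosure i<n above
        l<i , i<r = above⇒inside E i<n above in
    1+n≢n (sym (trans (cong d (sym (exit E l<i i<r (≤⇒≯ (n≤1+n _))))) (right-level E)))
    where i<n = <-trans (n<1+n i) 1+i<n

-- Totally nested partitions are mountains, and conversely

NestedByN : (ℕ → ℕ) → ℕ → ℕ → ℕ → Set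
NestedByN d n b b′ = ∃[ i ] ∃[ j ] (d i ≡ b′ × IsArc d n i j × (∀ {p} → p < n → d p ≡ b → i < p × p < j))

module NestedLevels {d n k} (bounded : ∀ {p} → p < n → d p < k)
                    (nested : ∀ {t} → suc t < k → NestedByN d n (suc t) t) where

  above⇒inside-arc : ∀ {t i j} → d i ≡ t → IsArc d n i j → (∀ {p} → p < n → d p ≡ suc t → i < p × p < j) →
                     ∀ s → t < s → ∀ {p} → p < n → d p ≡ s → i < p × p < j
  above⇒inside-arc di arc inner (suc s) t<1+s p<n dp≡1+s with m≤n⇒m<n∨m≡n (≤-pred t<1+s)
  ... | inj₂ refl = inner p<n dp≡1+s
  ... | inj₁ t<s with nested (subst (_< k) dp≡1+s (bounded p<n))
  ...   | i′ , j′ , di′ , arc′ , inner′ =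
    <-trans (proj₁ (recurse (start<n arc′) di′)) (proj₁ (inner′ p<n dp≡1+s)) ,
    <-trans (proj₂ (inner′ p<n dp≡1+s)) (proj₂ (recurse (end<n arc′) (trans (sym (same-block arc′)) di′)))
    where recurse = above⇒inside-arc di arc inner s t<s

  inside-arc⇒above : ∀ {t i j} → d i ≡ t → IsArc d n i j → (∀ {p} → p < n → d p ≡ suc t → i < p × p < j) →
                     ∀ {p} → i < p → p < j → t < d p
  inside-arc⇒above {t} {i} {j} di arc inner {p} i<p p<j with <-cmp t (d p)
  ... | tri< t<dp _ _ = t<dp
  ... | tri≈ _ t≡dp _ = ⊥-elim (none-between arc i<p p<j (trans (sym t≡dp) (sym di)))
  ... | tri> _ _ dp<t with nested (≤-<-trans dp<t (subst (_< k) di (bounded (start<n arc))))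
  ...   | i′ , j′ , di′ , arc′ , inner′ = ⊥-elim (none-between arc′
          (<-trans (proj₁ (around (start<n arc) di)) i<p)
          (<-trans p<j (proj₂ (around (end<n arc) (trans (sym (same-block arc)) di))))
          (sym di′))
    where around = above⇒inside-arc di′ arc′ inner′ t dp<t

  level-enclosure : ∀ {t} → suc t < k → Enclosure d n t
  level-enclosure 1+t<k with nested 1+t<k
  ... | i , j , di , arc , inner = record
    { left = i
    ; right = j
    ; left<right = start<end arc
    ; right<n = end<n arc
    ; left-level = di
    ; right-level = trans (sym (same-block arc)) di
    ; above⇒inside = λ p<n t<dp → above⇒inside-arc di arc inner _ t<dp p<n refl
    ; inside⇒above = inside-arc⇒above di arc inner
    }

  nested-levels⇒Mountain : 0 < n → Mountain d n
  nested-levels⇒Mountain 0<n =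
    enclosures⇒Mountain 0<n λ p<n t<dp → level-enclosure (<-≤-trans (s≤s t<dp) (bounded p<n))

argmax : ∀ (d : ℕ → ℕ) p → ∃[ q ] (q ≤ p × (∀ {r} → r ≤ p → d r ≤ d q))
argmax d zero = 0 , z≤n , λ { z≤n → ≤-refl }
argmax d (suc p) with argmax d p
... | q , q≤p , max with d (suc p) ≤? d q
...   | yes d1+p≤dq = q , m≤n⇒m≤1+n q≤p , bounded
  where
  bounded : ∀ {r} → r ≤ suc p → d r ≤ d q
  bounded r≤1+p with m≤n⇒m<n∨m≡n r≤1+p
  ... | inj₁ r<1+p = max (≤-pred r<1+p)
  ... | inj₂ refl  = d1+p≤dq
...   | no d1+p≰dq = suc p , ≤-refl , bounded
  where
  bounded : ∀ {r} → r ≤ suc p → d r ≤ d (suc p)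
  bounded r≤1+p with m≤n⇒m<n∨m≡n r≤1+p
  ... | inj₁ r<1+p = ≤-trans (max (≤-pred r<1+p)) (<⇒≤ (≰⇒> d1+p≰dq))
  ... | inj₂ refl  = ≤-refl

Mountain⇒TotallyNested : ∀ {n} (a : Vec ℕ n) → 0 < n → Mountain (at a) n → TotallyNested a
Mountain⇒TotallyNested {zero}  a ()
Mountain⇒TotallyNested {suc n} a _ mountain with argmax (at a) n
... | q₀ , q₀≤n , max =
  upTo (suc (at a q₀)) , (upTo⁺ _ , λ v → mk⇔ (occurs v) (bounded v)) ,
  Linked.applyUpTo⁺₁ (λ v → v) (suc (at a q₀)) (λ 1+v<1+m → nested (≤-pred 1+v<1+m))
  where
  q₀<n : q₀ < suc n
  q₀<n = s≤s q₀≤n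

  occurs : ∀ v → v ∈ upTo (suc (at a q₀)) → ∃[ i ] lookup a i ≡ v
  occurs v v∈ with m≤n⇒m<n∨m≡n (≤-pred (∈-upTo⁻ v∈))
  ... | inj₂ refl = fromℕ< q₀<n , lookup-fromℕ< a q₀<n
  ... | inj₁ v<m with mountain-attains mountain q₀<n v<m
  ...   | q , q<q₀ , e = fromℕ< q<n , trans (lookup-fromℕ< a q<n) e
    where q<n = <-trans q<q₀ q₀<n

  bounded : ∀ v → ∃[ i ] lookup a i ≡ v → v ∈ upTo (suc (at a q₀))
  bounded v (i , e) = ∈-upTo⁺ (s≤s (subst (_≤ at a q₀) (trans (sym (lookup≡at a i)) e)
                                      (max (≤-pred (toℕ<n i)))))

  nested : ∀ {v} → v < at a q₀ → NestedBy a (suc v) v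
  nested {v} v<m = fromℕ< (start<n (arc E)) , fromℕ< (end<n (arc E)) ,
    trans (lookup-fromℕ< a (start<n (arc E))) (left-level E) ,
    fromℕ<-IsArc a (arc E) ,
    λ i ai≡1+v →
      let inside = above⇒inside E (toℕ<n i) (subst (v <_) (trans (sym ai≡1+v) (lookup≡at a i)) ≤-refl) in
      subst (_< toℕ i) (sym (toℕ-fromℕ< (start<n (arc E)))) (proj₁ inside) ,
      subst (toℕ i <_) (sym (toℕ-fromℕ< (end<n (arc E)))) (proj₂ inside)
    where E = mountain-enclosure mountain q₀<n v<m

lookup-injective : ∀ {xs : List ℕ} → Unique xs → ∀ {i j} → List.lookup xs i ≡ List.lookup xs j → i ≡ j
lookup-injective (_ ∷ _)      {Fin.zero}  {Fin.zero}  _ = refl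
lookup-injective (x∉ ∷ _)     {Fin.zero}  {Fin.suc j} e = ⊥-elim (All.lookup x∉ (∈-lookup j) e)
lookup-injective (x∉ ∷ _)     {Fin.suc i} {Fin.zero}  e = ⊥-elim (All.lookup x∉ (∈-lookup i) (sym e))
lookup-injective (_ ∷ unique) {Fin.suc i} {Fin.suc j} e = cong Fin.suc (lookup-injective unique e)

linked-lookup : ∀ {R : ℕ → ℕ → Set} {xs} → Linked R xs → ∀ (i j : Fin (length xs)) →
                toℕ j ≡ suc (toℕ i) → R (List.lookup xs i) (List.lookup xs j)
linked-lookup (r ∷ _) Fin.zero    (Fin.suc Fin.zero) _ = r
linked-lookup (_ ∷ l) (Fin.suc i) (Fin.suc j)        e = linked-lookup l i j (suc-injective e)
linked-lookup (_ ∷ _) Fin.zero    (Fin.suc (Fin.suc _)) ()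
linked-lookup (_ ∷ _) _           Fin.zero             ()
linked-lookup [-]     Fin.zero    Fin.zero             ()

IsArc-resp : ∀ {f g n i j} → SameKernel f g n → SameKernel g f n → IsArc f n i j → IsArc g n i j
IsArc-resp fg gf arc = record
  { start<end = start<end arc
  ; end<n = end<n arc
  ; same-block = fg (start<n arc) (end<n arc) (same-block arc)
  ; none-between = λ i<k k<j gk≡gi →
      none-between arc i<k k<j (gf (<-trans k<j (end<n arc)) (start<n arc) gk≡gi)
  }

module _ {n} (a : Vec ℕ n) {L : List ℕ} (unique : Unique L)
         (blocks : ∀ v → (v ∈ L) ⇔ (∃[ i ] lookup a i ≡ v)) where

  private
    level-of : ∀ {p} → p < n → Fin (length L)
    level-of p<n = Any.index (Equivalence.from (blocks (at a _)) (fromℕ< p<n , lookup-fromℕ< a p<n))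

    lookup-level-of : ∀ {p} (p<n : p < n) → List.lookup L (level-of p<n) ≡ at a p
    lookup-level-of p<n =
      sym (lookup-index (Equivalence.from (blocks (at a _)) (fromℕ< p<n , lookup-fromℕ< a p<n)))

    level : ∀ {p} → Dec (p < n) → ℕ
    level (yes p<n) = toℕ (level-of p<n)
    level (no _)    = 0

    level-bound : ∀ {p} (p<n? : Dec (p < n)) → p < n → level p<n? < length L
    level-bound (yes p<n) _   = toℕ<n (level-of p<n)
    level-bound (no p≮n)  p<n = ⊥-elim (p≮n p<n)

    level-label : ∀ {p t} (p<n? : Dec (p < n)) → p < n → (t<k : t < length L) →
                  (level p<n? ≡ t) ⇔ (at a p ≡ List.lookup L (fromℕ< t<k))
    level-label (no p≮n)  p<n = ⊥-elim (p≮n p<n)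
    level-label (yes p<n) _   t<k = mk⇔
      (λ level≡t → trans (sym (lookup-level-of p<n))
                     (cong (List.lookup L) (toℕ-injective (trans level≡t (sym (toℕ-fromℕ< t<k))))))
      (λ e → trans (cong toℕ (lookup-injective unique (trans (lookup-level-of p<n) e))) (toℕ-fromℕ< t<k))

  -- The index in L of the block of p (0 beyond n).
  depth : ℕ → ℕ
  depth p = level (p <? n)

  depth<length : ∀ {p} → p < n → depth p < length L
  depth<length {p} = level-bound (p <? n)

  depth-label : ∀ {p t} → p < n → (t<k : t < length L) →
                (depth p ≡ t) ⇔ (at a p ≡ List.lookup L (fromℕ< t<k))
  depth-label {p} = level-label (p <? n)

  at≡⇒depth≡ : SameKernel (at a) depth n
  at≡⇒depth≡ p<n q<n e = Equivalence.from (depth-label p<n (depth<length q<n))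
    (trans e (Equivalence.to (depth-label q<n (depth<length q<n)) refl))

  depth≡⇒at≡ : SameKernel depth (at a) n
  depth≡⇒at≡ p<n q<n e = trans (Equivalence.to (depth-label p<n (depth<length q<n)) e)
    (sym (Equivalence.to (depth-label q<n (depth<length q<n)) refl))

  nested-depths : Linked (λ b′ b → NestedBy a b b′) L →
                  ∀ {t} → suc t < length L → NestedByN depth n (suc t) t
  nested-depths linked {t} 1+t<k =
    from-nesting (linked-lookup linked (fromℕ< t<k) (fromℕ< 1+t<k) consecutive)
    where
    t<k = <-trans (n<1+n t) 1+t<k
    consecutive : toℕ (fromℕ< 1+t<k) ≡ suc (toℕ (fromℕ< t<k))
    consecutive = trans (toℕ-fromℕ< 1+t<k) (cong suc (sym (toℕ-fromℕ< t<k)))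
    from-nesting : NestedBy a (List.lookup L (fromℕ< 1+t<k)) (List.lookup L (fromℕ< t<k)) →
                   NestedByN depth n (suc t) t
    from-nesting (j , j′ , aj≡Lt , A , inner) =
      toℕ j , toℕ j′ ,
      Equivalence.from (depth-label (toℕ<n j) t<k) (trans (sym (lookup≡at a j)) aj≡Lt) ,
      IsArc-resp at≡⇒depth≡ depth≡⇒at≡ (Arc⇒IsArc a A) ,
      λ {p} p<n dp≡1+t →
        let inside = inner (fromℕ< p<n)
                       (trans (lookup-fromℕ< a p<n) (Equivalence.to (depth-label p<n 1+t<k) dp≡1+t)) in
        subst (toℕ j <_) (toℕ-fromℕ< p<n) (proj₁ inside) , subst (_< toℕ j′) (toℕ-fromℕ< p<n) (proj₂ inside)

-- The depths form a mountain with the same kernel as the labels, so the two restricted growth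
-- functions coincide.
TotallyNested⇒Mountain : ∀ {n} (a : Vec ℕ n) → 0 < n → IsRGF a → TotallyNested a → Mountain (at a) n
TotallyNested⇒Mountain a 0<n rgf (L , (unique , blocks) , linked) =
  Mountain-resp 0<n
    (RG-unique (Mountain⇒RG mountain) (IsRGF⇒RG a rgf)
               (depth≡⇒at≡ a unique blocks) (at≡⇒depth≡ a unique blocks))
    mountain
  where
  mountain : Mountain (depth a unique blocks) _
  mountain = NestedLevels.nested-levels⇒Mountain (depth<length a unique blocks)
               (nested-depths a unique blocks linked) 0<n

-- Mountains are coded by the positions where they change

changes : (ℕ → ℕ) → ℕ → Bool
changes d p = isNo (d p ≟ d (pred p))

module _ {d n} (mountain : Mountain d n) where

  step-bounds : ∀ {i} → suc i < n →
                d (suc i) ≤ bit (changes d (suc i)) + d i × d i ≤ bit (changes d (suc i)) + d (suc i)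
  step-bounds {i} 1+i<n with d (suc i) ≟ d i
  ... | yes e = ≤-reflexive e , ≤-reflexive (sym e)
  ... | no _  = step-up mountain 1+i<n , step-down mountain 1+i<n

  rising-step : ∀ {i} → suc i < n → ¬ Descent d i → d (suc i) ≡ bit (changes d (suc i)) + d i
  rising-step {i} 1+i<n ¬descent with d (suc i) ≟ d i
  ... | yes e = e
  ... | no ne = ≤-antisym (step-up mountain 1+i<n) (≤∧≢⇒< (≮⇒≥ ¬descent) (λ e → ne (sym e)))

  falling-step : ∀ {i} → suc i < n → ¬ Ascent d i → d i ≡ bit (changes d (suc i)) + d (suc i)
  falling-step {i} 1+i<n ¬ascent with d (suc i) ≟ d i
  ... | yes e = sym e
  ... | no ne = ≤-antisym (step-down mountain 1+i<n) (≤∧≢⇒< (≮⇒≥ ¬ascent) ne)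

  private
    C : ℕ → ℕ
    C = count (changes d)

  -- Between p and q the height moves by at most the number of changes, and by exactly that number
  -- when the word does not turn; stated additively to avoid truncated subtraction.
  rise-bound : ∀ {p q} → p ≤ q → q < n → d q + C p ≤ d p + C q
  rise-bound {q = zero} z≤n _ = ≤-refl
  rise-bound {p} {suc q} p≤1+q 1+q<n with m≤n⇒m<n∨m≡n p≤1+q
  ... | inj₂ refl = ≤-refl
  ... | inj₁ p<1+q = begin
    d (suc q) + C p   ≤⟨ +-monoˡ-≤ (C p) (proj₁ (step-bounds 1+q<n)) ⟩
    (b + d q) + C p   ≡⟨ +-assoc b (d q) (C p) ⟩
    b + (d q + C p)   ≤⟨ +-monoʳ-≤ b (rise-bound (≤-pred p<1+q) (<-trans (n<1+n q) 1+q<n)) ⟩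
    b + (d p + C q)   ≡⟨ x∙yz≈y∙xz b (d p) (C q) ⟩
    d p + (b + C q)   ∎
    where b = bit (changes d (suc q))

  fall-bound : ∀ {p q} → p ≤ q → q < n → d p + C p ≤ d q + C q
  fall-bound {q = zero} z≤n _ = ≤-refl
  fall-bound {p} {suc q} p≤1+q 1+q<n with m≤n⇒m<n∨m≡n p≤1+q
  ... | inj₂ refl = ≤-refl
  ... | inj₁ p<1+q = begin
    d p + C p               ≤⟨ fall-bound (≤-pred p<1+q) (<-trans (n<1+n q) 1+q<n) ⟩
    d q + C q               ≤⟨ +-monoˡ-≤ (C q) (proj₂ (step-bounds 1+q<n)) ⟩
    (b + d (suc q)) + C q   ≡⟨ xy∙z≈y∙xz b (d (suc q)) (C q) ⟩
    d (suc q) + (b + C q)   ∎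
    where b = bit (changes d (suc q))

  rise-exact : ∀ {p q} → (∀ {i} → p ≤ i → i < q → ¬ Descent d i) → p ≤ q → q < n →
               d q + C p ≡ d p + C q
  rise-exact {q = zero} _ z≤n _ = refl
  rise-exact {p} {suc q} rising p≤1+q 1+q<n with m≤n⇒m<n∨m≡n p≤1+q
  ... | inj₂ refl = refl
  ... | inj₁ p<1+q = begin-equality
    d (suc q) + C p   ≡⟨ cong (_+ C p) (rising-step 1+q<n (rising (≤-pred p<1+q) ≤-refl)) ⟩
    (b + d q) + C p   ≡⟨ +-assoc b (d q) (C p) ⟩
    b + (d q + C p)   ≡⟨ cong (b +_) (rise-exact (λ p≤i i<q → rising p≤i (m≤n⇒m≤1+n i<q))
                                         (≤-pred p<1+q) (<-trans (n<1+n q) 1+q<n)) ⟩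
    b + (d p + C q)   ≡⟨ x∙yz≈y∙xz b (d p) (C q) ⟩
    d p + (b + C q)   ∎
    where b = bit (changes d (suc q))

  fall-exact : ∀ {p q} → (∀ {i} → p ≤ i → i < q → ¬ Ascent d i) → p ≤ q → q < n →
               d p + C p ≡ d q + C q
  fall-exact {q = zero} _ z≤n _ = refl
  fall-exact {p} {suc q} falling p≤1+q 1+q<n with m≤n⇒m<n∨m≡n p≤1+q
  ... | inj₂ refl = refl
  ... | inj₁ p<1+q = begin-equality
    d p + C p               ≡⟨ fall-exact (λ p≤i i<q → falling p≤i (m≤n⇒m≤1+n i<q))
                                 (≤-pred p<1+q) (<-trans (n<1+n q) 1+q<n) ⟩
    d q + C q               ≡⟨ cong (_+ C q) (falling-step 1+q<n (falling (≤-pred p<1+q) ≤-refl)) ⟩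
    (b + d (suc q)) + C q   ≡⟨ xy∙z≈y∙xz b (d (suc q)) (C q) ⟩
    d (suc q) + (b + C q)   ∎
    where b = bit (changes d (suc q))

  height-from-start : ∀ {p} → (∀ {i} → i < p → ¬ Descent d i) → p < n → d p ≡ C p
  height-from-start {p} rising p<n =
    trans (sym (+-identityʳ (d p))) (trans (rise-exact (λ _ i<p → rising i<p) z≤n p<n)
                                           (cong (_+ C p) (first≡0 mountain)))

  height-to-end : ∀ {m p} → suc m ≡ n → (∀ {j} → p ≤ j → j < m → ¬ Ascent d j) → p ≤ m →
                  d p + C p ≡ C m
  height-to-end {m} 1+m≡n falling p≤m =
    trans (fall-exact falling p≤m (subst (_ <_) 1+m≡n ≤-refl)) (cong (_+ C m) (last≡0 mountain 1+m≡n))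

  -- Before the first descent the height counts the changes so far, after it the changes to come.
  height : ∀ {m p} → suc m ≡ n → p ≤ m → d p ≡ C p ⊓ (C m ∸ C p)
  height {m} {p} 1+m≡n p≤m with anyUpTo? (λ i → d (suc i) <? d i) p
  ... | no no-descent = trans dp≡Cp (sym (m≤n⇒m⊓n≡m (m+n≤o⇒m≤o∸n (C p)
          (subst (λ x → x + C p ≤ C m) dp≡Cp (≤-trans (fall-bound p≤m m<n)
             (≤-reflexive (cong (_+ C m) (last≡0 mountain 1+m≡n))))))))
    where
    m<n = subst (m <_) 1+m≡n ≤-refl
    dp≡Cp : d p ≡ C p
    dp≡Cp = height-from-start (λ i<p descent → no-descent (_ , i<p , descent)) (≤-<-trans p≤m m<n)
  ... | yes (i , i<p , descent) = trans dp≡Cm∸Cp (sym (m≥n⇒m⊓n≡n (subst (_≤ C p) dp≡Cm∸Cp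
          (height-below (≤-<-trans p≤m (subst (m <_) 1+m≡n ≤-refl))))))
    where
    height-below : ∀ {p} → p < n → d p ≤ C p
    height-below {p} p<n =
      subst₂ _≤_ (+-identityʳ (d p)) (cong (_+ C p) (first≡0 mountain)) (rise-bound z≤n p<n)
    dp≡Cm∸Cp : d p ≡ C m ∸ C p
    dp≡Cm∸Cp = trans (sym (m+n∸n≡m (d p) (C p))) (cong (_∸ C p) (height-to-end 1+m≡n
      (λ p≤j j<m → unimodal mountain (<-≤-trans i<p p≤j) (subst (_ <_) 1+m≡n (s≤s j<m)) descent) p≤m))

  changes-even : ∀ {m} → suc m ≡ n → ∃[ h ] (C m ≡ h + h)
  changes-even {m} 1+m≡n with anyUpTo? (λ i → d (suc i) <? d i) m
  ... | no no-descent = 0 , trans (sym (height-from-start rising m<n)) (last≡0 mountain 1+m≡n)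
    where
    m<n = subst (m <_) 1+m≡n ≤-refl
    rising : ∀ {i} → i < m → ¬ Descent d i
    rising i<m descent = no-descent (_ , i<m , descent)
  ... | yes (i , i<m , descent) with least (λ i → d (suc i) <? d i) descent
  ...   | i₀ , i₀≤i , descent₀ , first = d i₀ ,
    trans (sym (height-to-end 1+m≡n no-ascent (<⇒≤ i₀<m)))
          (cong (d i₀ +_) (sym (height-from-start first i₀<n)))
    where
    i₀<m = ≤-<-trans i₀≤i i<m
    i₀<n = <-trans i₀<m (subst (m <_) 1+m≡n ≤-refl)
    no-ascent : ∀ {j} → i₀ ≤ j → j < m → ¬ Ascent d j
    no-ascent i₀≤j j<m ascent with m≤n⇒m<n∨m≡n i₀≤j
    ... | inj₁ i₀<j = unimodal mountain i₀<j (subst (_ <_) 1+m≡n (s≤s j<m)) descent₀ ascent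
    ... | inj₂ refl = <-asym descent₀ ascent

⌈n/2⌉-unique : ∀ {n h} → n ≤ h + h → h + h ≤ suc n → ⌈ n /2⌉ ≡ h
⌈n/2⌉-unique {zero}        {zero}  _  _  = refl
⌈n/2⌉-unique {zero}        {suc h} _  hi rewrite +-suc h h = ⊥-elim (n≮0 (≤-pred hi))
⌈n/2⌉-unique {suc _}       {zero}  () _
⌈n/2⌉-unique {suc zero}    {suc h} _  hi rewrite +-suc h h =
  cong suc (sym (m+n≡0⇒m≡0 h (n≤0⇒n≡0 (≤-pred (≤-pred hi)))))
⌈n/2⌉-unique {suc (suc n)} {suc h} lo hi rewrite +-suc h h =
  cong suc (⌈n/2⌉-unique (≤-pred (≤-pred lo)) (≤-pred (≤-pred hi)))

⌈n/2⌉-double : ∀ n → n ≤ ⌈ n /2⌉ + ⌈ n /2⌉ × ⌈ n /2⌉ + ⌈ n /2⌉ ≤ suc n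
⌈n/2⌉-double zero = z≤n , z≤n
⌈n/2⌉-double (suc zero) = s≤s z≤n , ≤-refl
⌈n/2⌉-double (suc (suc n)) rewrite +-suc ⌈ n /2⌉ ⌈ n /2⌉ =
  s≤s (s≤s (proj₁ (⌈n/2⌉-double n))) , s≤s (s≤s (proj₂ (⌈n/2⌉-double n)))

tent : ℕ → ℕ → ℕ
tent K x = x ⊓ (K + K ∸ x)

m∸n≤1+[m∸1+n] : ∀ m n → m ∸ n ≤ suc (m ∸ suc n)
m∸n≤1+[m∸1+n] zero    zero    = z≤n
m∸n≤1+[m∸1+n] zero    (suc n) = z≤n
m∸n≤1+[m∸1+n] (suc m) zero    = ≤-refl
m∸n≤1+[m∸1+n] (suc m) (suc n) = m∸n≤1+[m∸1+n] m n

m∸n≡1+[m∸1+n] : ∀ {m n} → n < m → m ∸ n ≡ suc (m ∸ suc n)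
m∸n≡1+[m∸1+n] {suc m} {zero}  _         = refl
m∸n≡1+[m∸1+n] {suc m} {suc n} (s≤s n<m) = m∸n≡1+[m∸1+n] n<m

tent-step : ∀ K x → tent K (suc x) ≤ suc (tent K x) × tent K x ≤ suc (tent K (suc x))
tent-step K x =
  ⊓-mono-≤ (≤-refl {suc x}) (≤-trans (∸-monoʳ-≤ (K + K) (n≤1+n x)) (n≤1+n _)) ,
  ⊓-mono-≤ (≤-trans (n≤1+n x) (n≤1+n (suc x))) (m∸n≤1+[m∸1+n] (K + K) x)

tent-drop : ∀ {K x y} → x ≤ y → tent K y < tent K x → K + K ∸ y < y
tent-drop {K} {x} {y} x≤y drop = ≰⇒> λ y≤R →
  <⇒≱ drop (≤-trans (m⊓n≤m x _) (≤-trans x≤y (≤-reflexive (sym (m≤n⇒m⊓n≡m y≤R)))))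

tent-rise : ∀ {K x y} → x ≤ y → tent K x < tent K y → x < K + K ∸ x
tent-rise {K} {x} {y} x≤y rise = ≰⇒> λ R≤x →
  <⇒≱ rise (≤-trans (m⊓n≤n y _) (≤-trans (∸-monoʳ-≤ (K + K) x≤y) (≤-reflexive (sym (m≥n⇒m⊓n≡n R≤x)))))

tent-suc≢ : ∀ {K x} → suc x ≤ K + K → tent K (suc x) ≢ tent K x
tent-suc≢ {K} {x} 1+x≤2K e with suc x ≤? K
... | yes 1+x≤K = 1+n≢n (trans (sym (m≤n⇒m⊓n≡m (rising 1+x≤K)))
                          (trans e (m≤n⇒m⊓n≡m (rising (≤-trans (n≤1+n x) 1+x≤K)))))
  where
  rising : ∀ {y} → y ≤ K → y ≤ K + K ∸ y
  rising y≤K = m+n≤o⇒m≤o∸n _ (+-mono-≤ y≤K y≤K)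
... | no 1+x≰K = 1+n≢n (sym (begin-equality
  K + K ∸ suc x          ≡⟨ sym (m≥n⇒m⊓n≡n falling₁) ⟩
  tent K (suc x)         ≡⟨ e ⟩
  tent K x               ≡⟨ m≥n⇒m⊓n≡n falling₀ ⟩
  K + K ∸ x              ≡⟨ m∸n≡1+[m∸1+n] 1+x≤2K ⟩
  suc (K + K ∸ suc x)    ∎))
  where
  K≤x = ≤-pred (≰⇒> 1+x≰K)
  falling₀ : K + K ∸ x ≤ x
  falling₀ = ≤-trans (∸-monoˡ-≤ x (+-mono-≤ K≤x K≤x)) (≤-reflexive (m+n∸n≡m x x))
  falling₁ : K + K ∸ suc x ≤ suc x
  falling₁ = ≤-trans (∸-monoʳ-≤ (K + K) (n≤1+n x)) (≤-trans falling₀ (n≤1+n x))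

-- With N inner changes the word changes 2⌈N/2⌉ times in all, the last step restoring the parity.
mountainOf : ℕ → (ℕ → Bool) → ℕ → ℕ
mountainOf n β p = if isYes (suc p <? n) then tent ⌈ count β (n ∸ 2) /2⌉ (count β p) else 0

mountainOf-inner : ∀ {n β p} → suc p < n → mountainOf n β p ≡ tent ⌈ count β (n ∸ 2) /2⌉ (count β p)
mountainOf-inner {n} {β} {p} 1+p<n with suc p <? n
... | yes _      = refl
... | no 1+p≮n = ⊥-elim (1+p≮n 1+p<n)

mountainOf-last : ∀ {n β p} → ¬ suc p < n → mountainOf n β p ≡ 0
mountainOf-last {n} {β} {p} 1+p≮n with suc p <? n
... | yes 1+p<n = ⊥-elim (1+p≮n 1+p<n)
... | no _      = refl

count-step : ∀ β p → count β (suc p) ≡ count β p ⊎ count β (suc p) ≡ suc (count β p)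
count-step β p with β (suc p)
... | false = inj₁ refl
... | true  = inj₂ refl

≤∸2⇒< : ∀ {q n} → 0 < q → q ≤ n ∸ 2 → suc q < n
≤∸2⇒< {n = suc (suc n)} _   q≤n = s≤s (s≤s q≤n)
≤∸2⇒< {n = zero}        0<q q≤0 = ⊥-elim (<⇒≱ 0<q q≤0)
≤∸2⇒< {n = suc zero}    0<q q≤0 = ⊥-elim (<⇒≱ 0<q q≤0)

<⇒≤∸2 : ∀ {p n} → suc p < n → p ≤ n ∸ 2
<⇒≤∸2 {p} {n} 1+p<n = m+n≤o⇒m≤o∸n p (subst (_≤ n) (+-comm 2 p) 1+p<n)

module _ (n : ℕ) (β : ℕ → Bool) where

  private
    N = count β (n ∸ 2)
    K = ⌈ N /2⌉
    h = mountainOf n β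

  mountainOf-inner-steps : ∀ {i} → suc (suc i) < n → h (suc i) ≤ suc (h i) × h i ≤ suc (h (suc i))
  mountainOf-inner-steps {i} 2+i<n
    rewrite mountainOf-inner {β = β} 2+i<n | mountainOf-inner {β = β} (<-trans (n<1+n (suc i)) 2+i<n)
    with count-step β i
  ... | inj₁ same = subst (λ c → tent K c ≤ suc (tent K (count β i)) × tent K (count β i) ≤ suc (tent K c))
                      (sym same) (n≤1+n _ , n≤1+n _)
  ... | inj₂ next = subst (λ c → tent K c ≤ suc (tent K (count β i)) × tent K (count β i) ≤ suc (tent K c))
                      (sym next) (tent-step K (count β i))

  mountainOf-step-up : ∀ {i} → suc i < n → h (suc i) ≤ suc (h i)
  mountainOf-step-up {i} _ = by-cases (suc (suc i) <? n)
    where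
    by-cases : Dec (suc (suc i) < n) → h (suc i) ≤ suc (h i)
    by-cases (yes 2+i<n) = proj₁ (mountainOf-inner-steps 2+i<n)
    by-cases (no 2+i≮n)  = subst (_≤ suc (h i)) (sym (mountainOf-last 2+i≮n)) z≤n

  mountainOf-step-down : ∀ {i} → suc i < n → h i ≤ suc (h (suc i))
  mountainOf-step-down {i} 1+i<n = by-cases (suc (suc i) <? n)
    where
    by-cases : Dec (suc (suc i) < n) → h i ≤ suc (h (suc i))
    by-cases (yes 2+i<n) = proj₂ (mountainOf-inner-steps 2+i<n)
    by-cases (no 2+i≮n) =
      subst₂ (λ x y → x ≤ suc y) (sym (mountainOf-inner 1+i<n)) (sym (mountainOf-last 2+i≮n))
      (≤-trans (m⊓n≤n _ (K + K ∸ count β i)) (subst (λ c → K + K ∸ count β c ≤ 1) (sym i≡n∸2) last-step))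
      where
      i≡n∸2 : i ≡ n ∸ 2
      i≡n∸2 = cong (_∸ 2) (≤-antisym 1+i<n (≮⇒≥ 2+i≮n))
      last-step : K + K ∸ N ≤ 1
      last-step = ≤-trans (∸-monoˡ-≤ N (proj₂ (⌈n/2⌉-double N))) (≤-reflexive (m+n∸n≡m 1 N))

  mountainOf-unimodal : ∀ {i j} → i < j → suc j < n → Descent h i → ¬ Ascent h j
  mountainOf-unimodal {i} {j} i<j 1+j<n descent ascent = by-cases (suc (suc j) <? n)
    where
    R = λ c → K + K ∸ c
    by-cases : Dec (suc (suc j) < n) → ⊥
    by-cases (no 2+j≮n) = n≮0 (subst (h j <_) (mountainOf-last 2+j≮n) ascent)
    by-cases (yes 2+j<n) = <-irrefl refl (begin-strict
      R (count β (suc i)) <⟨ tent-drop {K} (count-mono β (n≤1+n i))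
                               (subst₂ _<_ (mountainOf-inner 2+i<n) (mountainOf-inner 1+i<n) descent) ⟩
      count β (suc i)     ≤⟨ count-mono β i<j ⟩
      count β j           <⟨ tent-rise {K} (count-mono β (n≤1+n j))
                               (subst₂ _<_ (mountainOf-inner 1+j<n) (mountainOf-inner 2+j<n) ascent) ⟩
      R (count β j)       ≤⟨ ∸-monoʳ-≤ (K + K) (count-mono β i<j) ⟩
      R (count β (suc i)) ∎)
      where
      2+i<n = ≤-<-trans (s≤s i<j) 1+j<n
      1+i<n = <-trans (n<1+n (suc i)) 2+i<n

  mountainOf-Mountain : Mountain h n
  mountainOf-Mountain = record
    { first≡0 = first
    ; last≡0 = λ 1+p≡n → mountainOf-last (λ 1+p<n → <-irrefl 1+p≡n 1+p<n)
    ; step-up = mountainOf-step-up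
    ; step-down = mountainOf-step-down
    ; unimodal = mountainOf-unimodal
    }
    where
    first : h 0 ≡ 0
    first with 1 <? n
    ... | yes _ = refl
    ... | no _  = refl

changes-mountainOf : ∀ {n β p} → Inner n p → changes (mountainOf n β) p ≡ β p
changes-mountainOf {n} {β} {suc p} (_ , 2+p<n) = by-value (β (suc p)) refl
  where
  1+p<n = <-trans (n<1+n (suc p)) 2+p<n
  K = ⌈ count β (n ∸ 2) /2⌉
  values : mountainOf n β (suc p) ≡ tent K (count β (suc p)) × mountainOf n β p ≡ tent K (count β p)
  values = mountainOf-inner 2+p<n , mountainOf-inner 1+p<n
  by-value : ∀ b → β (suc p) ≡ b → changes (mountainOf n β) (suc p) ≡ b
  by-value false βp = isNo-≡ (trans (proj₁ values) (trans (cong (tent K) count≡) (sym (proj₂ values))))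
    where
    count≡ : count β (suc p) ≡ count β p
    count≡ rewrite βp = refl
  by-value true βp = isNo-≢ λ e → tent-suc≢ {K} (≤-trans bounded (proj₁ (⌈n/2⌉-double (count β (n ∸ 2)))))
    (trans (cong (tent K) (sym (count-true p βp))) (trans (sym (proj₁ values)) (trans e (proj₂ values))))
    where
    bounded : suc (count β p) ≤ count β (n ∸ 2)
    bounded = subst (_≤ count β (n ∸ 2)) (count-true p βp) (count-mono β (<⇒≤∸2 2+p<n))

mountainOf-cong : ∀ {n β γ} → (∀ {q} → Inner n q → β q ≡ γ q) → ∀ p → mountainOf n β p ≡ mountainOf n γ p
mountainOf-cong {n} {β} {γ} eq p = by-cases (suc p <? n)
  where
  by-cases : Dec (suc p < n) → mountainOf n β p ≡ mountainOf n γ p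
  by-cases (no 1+p≮n) = trans (mountainOf-last 1+p≮n) (sym (mountainOf-last 1+p≮n))
  by-cases (yes 1+p<n) = begin-equality
    mountainOf n β p                                 ≡⟨ mountainOf-inner 1+p<n ⟩
    tent ⌈ count β (n ∸ 2) /2⌉ (count β p)
      ≡⟨ cong₂ (λ c x → tent ⌈ c /2⌉ x)
           (count-cong (n ∸ 2) λ 0<q q≤ → eq (0<q , ≤∸2⇒< 0<q q≤))
           (count-cong p λ 0<q q≤p → eq (0<q , ≤-<-trans (s≤s q≤p) 1+p<n)) ⟩
    tent ⌈ count γ (n ∸ 2) /2⌉ (count γ p)          ≡⟨ sym (mountainOf-inner 1+p<n) ⟩
    mountainOf n γ p                                 ∎

mountainOf-changes : ∀ {d n} → Mountain d n → ∀ {p} → p < n → mountainOf n (changes d) p ≡ d p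
mountainOf-changes {n = zero}     _        ()
mountainOf-changes {n = suc zero} mountain {zero}  _         = sym (first≡0 mountain)
mountainOf-changes {n = suc zero} _        {suc _} (s≤s ())
mountainOf-changes {d} {suc (suc k)} mountain {p} p<n = by-cases (suc p <? suc (suc k))
  where
  C = count (changes d)
  by-cases : Dec (suc p < suc (suc k)) → mountainOf (suc (suc k)) (changes d) p ≡ d p
  by-cases (no 1+p≮n) = trans (mountainOf-last 1+p≮n)
    (sym (last≡0 mountain (≤-antisym p<n (≮⇒≥ 1+p≮n))))
  by-cases (yes 1+p<n) with changes-even mountain {suc k} refl
  ... | h , total≡h+h = begin-equality
    mountainOf (suc (suc k)) (changes d) p ≡⟨ mountainOf-inner 1+p<n ⟩
    tent ⌈ C k /2⌉ (C p)                    ≡⟨ cong (λ K → tent K (C p)) ⌈Ck/2⌉≡h ⟩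
    C p ⊓ (h + h ∸ C p)                     ≡⟨ cong (λ T → C p ⊓ (T ∸ C p)) (sym total≡h+h) ⟩
    C p ⊓ (C (suc k) ∸ C p)                 ≡⟨ sym (height mountain refl (<⇒≤ (≤-pred 1+p<n))) ⟩
    d p                                     ∎
    where
    ⌈Ck/2⌉≡h : ⌈ C k /2⌉ ≡ h
    ⌈Ck/2⌉≡h = ⌈n/2⌉-unique
      (subst (C k ≤_) total≡h+h (m≤n+m (C k) (bit (changes d (suc k)))))
      (subst (_≤ suc (C k)) total≡h+h (+-monoˡ-≤ (C k) (bit≤1 (changes d (suc k)))))

Codes : ℕ → Setoid 0ℓ 0ℓ
Codes n = record
  { Carrier = ℕ → Bool
  ; _≈_ = λ β γ → ∀ {p} → Inner n p → β p ≡ γ p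
  ; isEquivalence = record
    { refl = λ _ → refl
    ; sym = λ β≈γ inner → sym (β≈γ inner)
    ; trans = λ β≈γ γ≈δ inner → trans (β≈γ inner) (γ≈δ inner)
    }
  }

Pincn⤖Codes : ∀ n → Bijection (Pincn n) (Codes n)
Pincn⤖Codes n = record
  { to = λ x → singletons (at (proj₁ x))
  ; cong = λ a≡b {p} _ → cong (λ a → singletons (at a) p) a≡b
  ; bijective = (λ {x} {y} → injective {x} {y}) , surjective
  }
  where
  open Setoid (Pincn n) using () renaming (Carrier to Pinc)
  open Setoid (Codes n) using () renaming (_≈_ to _≈ᶜ_)

  injective : ∀ {x y : Pinc} → singletons (at (proj₁ x)) ≈ᶜ singletons (at (proj₁ y)) → proj₁ x ≡ proj₁ y
  injective {a , rgfa , propsa} {b , rgfb , propsb} a≈b = at-injective λ {p} p<n →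
    trans (sym (combOf-singletons (Pincn⇒Comb a rgfa propsa) p<n))
          (trans (combOf-cong a≈b p) (combOf-singletons (Pincn⇒Comb b rgfb propsb) p<n))

  surjective : ∀ γ → ∃ λ (x : Pinc) → ∀ {z : Pinc} → proj₁ z ≡ proj₁ x → singletons (at (proj₁ z)) ≈ᶜ γ
  surjective γ =
    (a , RG⇒IsRGF (rg comb) ,
     Comb⇒Indecomposable a comb′ , Comb⇒Noncrossing a comb′ , Comb⇒Nonnesting a comb′) ,
    λ { refl {p} inner →
          trans (cong (λ x → isNo (x ≟ 0)) (at-vec n (combOf n γ) (<-trans (n<1+n p) (proj₂ inner))))
                (singletons-combOf inner) }
    where
    a = vec n (combOf n γ)
    comb = combOf-Comb n γ
    comb′ : Comb (at a) n
    comb′ = Comb-resp (λ p<n → sym (at-vec n (combOf n γ) p<n)) comb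

Codes⤖Ptn : ∀ n → 0 < n → Bijection (Codes n) (Ptn n)
Codes⤖Ptn n 0<n = record
  { to = λ β → vec n (mountainOf n β) , RG⇒IsRGF (Mountain⇒RG (mountainOf-Mountain n β)) ,
               Mountain⇒TotallyNested (vec n (mountainOf n β)) 0<n
                 (Mountain-resp 0<n (λ p<n → sym (at-vec n (mountainOf n β) p<n)) (mountainOf-Mountain n β))
  ; cong = λ β≈γ → at-injective λ {p} p<n →
      trans (at-vec n _ p<n) (trans (mountainOf-cong β≈γ p) (sym (at-vec n _ p<n)))
  ; bijective = (λ {β} {γ} → injective {β} {γ}) , surjective
  }
  where
  open Setoid (Ptn n) using () renaming (Carrier to Pt)
  open Setoid (Codes n) using () renaming (_≈_ to _≈ᶜ_)

  agree : ∀ {β γ} → vec n (mountainOf n β) ≡ vec n (mountainOf n γ) → ∀ {p} → p < n →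
          mountainOf n β p ≡ mountainOf n γ p
  agree eq {p} p<n = trans (sym (at-vec n _ p<n)) (trans (cong (λ v → at v p) eq) (at-vec n _ p<n))

  injective : ∀ {β γ} → vec n (mountainOf n β) ≡ vec n (mountainOf n γ) → β ≈ᶜ γ
  injective eq {p} inner = trans (sym (changes-mountainOf inner))
    (trans (cong₂ (λ x y → isNo (x ≟ y)) (agree eq p<n) (agree eq (≤-<-trans pred[n]≤n p<n)))
           (changes-mountainOf inner))
    where p<n = <-trans (n<1+n p) (proj₂ inner)

  surjective : ∀ (y : Pt) → ∃ λ β → ∀ {γ} → γ ≈ᶜ β → vec n (mountainOf n γ) ≡ proj₁ y
  surjective (d , rgf , tn) = changes (at d) , λ γ≈ → at-injective λ {p} p<n →
    trans (at-vec n _ p<n) (trans (mountainOf-cong γ≈ p)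
      (mountainOf-changes (TotallyNested⇒Mountain d 0<n rgf tn) p<n))

theorem5p3 : (n : ℕ) → 1 ≤ n → Bijection (Pincn n) (Ptn n)
theorem5p3 n 1≤n = bijection (Pincn⤖Codes n) (Codes⤖Ptn n 1≤n)
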